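{- Let $a\in\mathbb{Z}_{\geq1}$ and let $m\ge4$ be an integer with $m\not\equiv 3\pmod{2a+1}$. Let $r_a=\big\lfloor\frac{am-(a-1)}{2a+1}\big\rfloor+1$. Then for every integer $i$ with $1\le i<r_a$, $$\binom{m}{i-1}a^{i-1}+\binom{m}{i}a^{i}\le\binom{m}{i+1}a^{i}-\binom{m}{i-1}a^{i-2}.$$ -}

module Defs where

open import Data.Nat as ℕ using (ℕ; suc; _*_; _+_; _∸_; NonZero)
open import Data.Nat.Combinatorics using (_C_)
open import Data.Integer using (+_)
open import Data.Rational using (ℚ; _/_)

-- r_a = ⌊ (a m - (a - 1)) / (2a + 1) ⌋ + 1.
-- For a ≥ 1, m ≥ 0 we have a m ≥ a - 1, so truncated subtraction is exact
-- and the floor of a nonnegative rational is natural-number division.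
r : ℕ → ℕ → ℕ
r a m = ((a * m ∸ (a ∸ 1)) ℕ./ (suc (2 * a))) + 1

⟦_⟧ : ℕ → ℚ
⟦ n ⟧ = (+ n) / 1

-- the rational number a^(k - 2) (integer exponent, possibly negative),
-- written as a^k / a^2; requires a ≠ 0
pow-2 : (a k : ℕ) → 1 ℕ.≤ a → ℚ
pow-2 (suc b) k _ = (+ (suc b ℕ.^ k)) / (suc b * suc b)

-- Write c₀, c₁, c₂ for C(m, i-1), C(m, i), C(m, i+1). Dividing by a^(i-2), the inequality
-- becomes c₀(a + 1) + c₁a² ≤ c₂a². The bound i < r_a says i(2a+1) + a - 1 ≤ am, and
-- equality there forces m ≡ 3 (mod 2a+1); so m = 2i + 1 + k with i ≤ ak. The ratios
-- i c₁ = (i + 2 + k) c₀ and (i + 1) c₂ = (i + 1 + k) c₁ then reduce the claim to the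
-- polynomial inequality i(i + 1)(a + 1) ≤ a²k(i + 2 + k), which follows from i ≤ ak.
module Submission where

open import Defs
open import Data.Nat using (ℕ; suc; _≤_; _<_; _^_; _∸_; _*_; _%_)
open import Data.Nat.Combinatorics using (_C_)
open import Data.Rational as ℚ using (ℚ)
open import Relation.Binary.PropositionalEquality using (_≢_)

open import Data.Nat as ℕ using (zero; _+_; NonZero)
open import Data.Nat.Properties
open import Data.Nat.DivMod using ([m+kn]%n≡m%n; m/n*n≤m)
open import Data.Nat.Combinatorics using (nC1≡n; nCk+nC[k+1]≡[n+1]C[k+1])
open import Data.Nat.Tactic.RingSolver using (solve; solve-∀)
open import Data.List using (_∷_; [])
open import Data.Product using (∃-syntax; _×_; _,_)
open import Relation.Binary.PropositionalEquality
  using (_≡_; refl; sym; trans; cong; cong₂; subst; module ≡-Reasoning)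
open import Data.Integer as ℤ using (+_; 1ℤ)
import Data.Integer.Properties as ℤ
open import Data.Rational.Properties using (toℚᵘ-cancel-≤; toℚᵘ-fromℚᵘ; toℚᵘ-homo-+; toℚᵘ-homo-*; toℚᵘ-homo‿-)
open import Data.Rational.Unnormalised as ℚᵘ using (ℚᵘ; mkℚᵘ; *≤*; ↥_; ↧_)
import Data.Rational.Unnormalised.Properties as ℚᵘ

⟦_⟧ᵘ : ℕ → ℚᵘ
⟦ n ⟧ᵘ = mkℚᵘ (+ n) 0

↥⟦⟧ᵘ+⟦⟧ᵘ : ∀ x y → ↥ (⟦ x ⟧ᵘ ℚᵘ.+ ⟦ y ⟧ᵘ) ≡ + (x + y)
↥⟦⟧ᵘ+⟦⟧ᵘ x y = trans (cong₂ ℤ._+_ (ℤ.*-identityʳ (+ x)) (ℤ.*-identityʳ (+ y))) (sym (ℤ.pos-+ x y))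

↥⟦⟧ᵘ-⟦⟧ᵘ*q : ∀ z c n d → ↥ (⟦ z ⟧ᵘ ℚᵘ.- ⟦ c ⟧ᵘ ℚᵘ.* mkℚᵘ (+ n) d) ≡ (z * suc d) ℤ.⊖ (c * n)
↥⟦⟧ᵘ-⟦⟧ᵘ*q z c n d = begin
  + z ℤ.* + suc (d + 0) ℤ.+ ℤ.- (+ c ℤ.* + n) ℤ.* 1ℤ
    ≡⟨ cong₂ ℤ._+_ (cong (λ e → + z ℤ.* + suc e) (+-identityʳ d)) (ℤ.*-identityʳ _) ⟩
  + z ℤ.* + suc d ℤ.- + c ℤ.* + n
    ≡⟨ cong₂ ℤ._-_ (ℤ.pos-* z (suc d)) (ℤ.pos-* c n) ⟨
  + (z * suc d) ℤ.- + (c * n)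
    ≡⟨ ℤ.m-n≡m⊖n (z * suc d) (c * n) ⟩
  (z * suc d) ℤ.⊖ (c * n) ∎
  where open ≡-Reasoning

↧⟦⟧ᵘ-⟦⟧ᵘ*q : ∀ z c n d → ↧ (⟦ z ⟧ᵘ ℚᵘ.- ⟦ c ⟧ᵘ ℚᵘ.* mkℚᵘ (+ n) d) ≡ + suc d
↧⟦⟧ᵘ-⟦⟧ᵘ*q z c n d = cong (λ e → + suc e) (trans (+-identityʳ _) (+-identityʳ d))

⟦⟧ᵘ+⟦⟧ᵘ≤⟦⟧ᵘ-⟦⟧ᵘ*q : ∀ x y z c n d → (x + y) * suc d + c * n ≤ z * suc d →
                     ⟦ x ⟧ᵘ ℚᵘ.+ ⟦ y ⟧ᵘ ℚᵘ.≤ ⟦ z ⟧ᵘ ℚᵘ.- ⟦ c ⟧ᵘ ℚᵘ.* mkℚᵘ (+ n) d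
⟦⟧ᵘ+⟦⟧ᵘ≤⟦⟧ᵘ-⟦⟧ᵘ*q x y z c n d h = *≤* (begin
  ↥ (⟦ x ⟧ᵘ ℚᵘ.+ ⟦ y ⟧ᵘ) ℤ.* ↧ (⟦ z ⟧ᵘ ℚᵘ.- ⟦ c ⟧ᵘ ℚᵘ.* mkℚᵘ (+ n) d)
    ≡⟨ cong₂ ℤ._*_ (↥⟦⟧ᵘ+⟦⟧ᵘ x y) (↧⟦⟧ᵘ-⟦⟧ᵘ*q z c n d) ⟩
  + (x + y) ℤ.* + suc d           ≡⟨ ℤ.pos-* (x + y) (suc d) ⟨
  + ((x + y) * suc d)             ≤⟨ ℤ.+≤+ (m+n≤o⇒m≤o∸n _ h) ⟩
  + (z * suc d ∸ c * n)           ≡⟨ ℤ.⊖-≥ (m+n≤o⇒n≤o ((x + y) * suc d) h) ⟨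
  (z * suc d) ℤ.⊖ (c * n)         ≡⟨ ↥⟦⟧ᵘ-⟦⟧ᵘ*q z c n d ⟨
  ↥ (⟦ z ⟧ᵘ ℚᵘ.- ⟦ c ⟧ᵘ ℚᵘ.* mkℚᵘ (+ n) d)
    ≡⟨ ℤ.*-identityʳ _ ⟨
  ↥ (⟦ z ⟧ᵘ ℚᵘ.- ⟦ c ⟧ᵘ ℚᵘ.* mkℚᵘ (+ n) d) ℤ.* ↧ (⟦ x ⟧ᵘ ℚᵘ.+ ⟦ y ⟧ᵘ) ∎)
  where open ℤ.≤-Reasoning

⟦⟧+⟦⟧≤⟦⟧-⟦⟧*pow-2 : ∀ {a} k x y z c (ha : 1 ≤ a) → (x + y) * (a * a) + c * a ^ k ≤ z * (a * a) →
                    ⟦ x ⟧ ℚ.+ ⟦ y ⟧ ℚ.≤ ⟦ z ⟧ ℚ.- ⟦ c ⟧ ℚ.* pow-2 a k ha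
⟦⟧+⟦⟧≤⟦⟧-⟦⟧*pow-2 {suc b} k x y z c ha h = toℚᵘ-cancel-≤ (begin
  ℚ.toℚᵘ (⟦ x ⟧ ℚ.+ ⟦ y ⟧)
    ≃⟨ ℚᵘ.≃-trans (toℚᵘ-homo-+ ⟦ x ⟧ ⟦ y ⟧) (ℚᵘ.+-cong (toℚᵘ-⟦⟧ x) (toℚᵘ-⟦⟧ y)) ⟩
  ⟦ x ⟧ᵘ ℚᵘ.+ ⟦ y ⟧ᵘ
    ≤⟨ ⟦⟧ᵘ+⟦⟧ᵘ≤⟦⟧ᵘ-⟦⟧ᵘ*q x y z c (suc b ^ k) (b + b * suc b) h ⟩
  ⟦ z ⟧ᵘ ℚᵘ.- ⟦ c ⟧ᵘ ℚᵘ.* q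
    ≃⟨ ℚᵘ.+-cong (toℚᵘ-⟦⟧ z) (ℚᵘ.-‿cong (ℚᵘ.≃-trans (toℚᵘ-homo-* ⟦ c ⟧ (pow-2 (suc b) k ha))
                                                    (ℚᵘ.*-cong (toℚᵘ-⟦⟧ c) (toℚᵘ-fromℚᵘ q)))) ⟨
  ℚ.toℚᵘ ⟦ z ⟧ ℚᵘ.- ℚ.toℚᵘ (⟦ c ⟧ ℚ.* pow-2 (suc b) k ha)
    ≃⟨ ℚᵘ.≃-trans (toℚᵘ-homo-+ ⟦ z ⟧ _) (ℚᵘ.+-congʳ (ℚ.toℚᵘ ⟦ z ⟧) (toℚᵘ-homo‿- _)) ⟨
  ℚ.toℚᵘ (⟦ z ⟧ ℚ.- ⟦ c ⟧ ℚ.* pow-2 (suc b) k ha) ∎)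
  where
  open ℚᵘ.≤-Reasoning
  q : ℚᵘ
  q = mkℚᵘ (+ suc b ^ k) (b + b * suc b)
  toℚᵘ-⟦⟧ : ∀ n → ℚ.toℚᵘ ⟦ n ⟧ ℚᵘ.≃ ⟦ n ⟧ᵘ
  toℚᵘ-⟦⟧ n = toℚᵘ-fromℚᵘ ⟦ n ⟧ᵘ

[k+1]*nC[k+1]+k*nCk≡n*nCk : ∀ n k → suc k * (n C suc k) + k * (n C k) ≡ n * (n C k)
[k+1]*nC[k+1]+k*nCk≡n*nCk zero    zero    = refl
[k+1]*nC[k+1]+k*nCk≡n*nCk zero    (suc k) = cong₂ _+_ (*-zeroʳ (suc (suc k))) (*-zeroʳ (suc k))
[k+1]*nC[k+1]+k*nCk≡n*nCk (suc n) zero    = begin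
  1 * (suc n C 1) + 0  ≡⟨ trans (+-identityʳ _) (*-identityˡ _) ⟩
  suc n C 1            ≡⟨ nC1≡n (suc n) ⟩
  suc n                ≡⟨ *-identityʳ (suc n) ⟨
  suc n * 1            ∎
  where open ≡-Reasoning
[k+1]*nC[k+1]+k*nCk≡n*nCk (suc n) (suc k) = begin
  suc (suc k) * (suc n C suc (suc k)) + suc k * (suc n C suc k)
    ≡⟨ cong₂ (λ u v → suc (suc k) * u + suc k * v) (pascal (suc k)) (pascal k) ⟨
  suc (suc k) * (B + D) + suc k * (A + B)
    ≡⟨ regroup₁ k A B D ⟩
  (suc (suc k) * B + suc k * A) + (suc (suc k) * D + suc k * B)
    ≡⟨ cong (λ v → (suc (suc k) * B + suc k * A) + v) ([k+1]*nC[k+1]+k*nCk≡n*nCk n (suc k)) ⟩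
  (suc (suc k) * B + suc k * A) + n * B
    ≡⟨ regroup₂ k n A B ⟩
  (B + A + n * B) + (suc k * B + k * A)
    ≡⟨ cong (λ v → (B + A + n * B) + v) ([k+1]*nC[k+1]+k*nCk≡n*nCk n k) ⟩
  (B + A + n * B) + n * A
    ≡⟨ regroup₃ n A B ⟩
  suc n * (A + B)
    ≡⟨ cong (suc n *_) (pascal k) ⟩
  suc n * (suc n C suc k) ∎
  where
  open ≡-Reasoning
  pascal = nCk+nC[k+1]≡[n+1]C[k+1] n
  A = n C k
  B = n C suc k
  D = n C suc (suc k)
  regroup₁ : ∀ k A B D → suc (suc k) * (B + D) + suc k * (A + B)
                       ≡ (suc (suc k) * B + suc k * A) + (suc (suc k) * D + suc k * B)
  regroup₁ = solve-∀
  regroup₂ : ∀ k n A B → (suc (suc k) * B + suc k * A) + n * B ≡ (B + A + n * B) + (suc k * B + k * A)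
  regroup₂ = solve-∀
  regroup₃ : ∀ n A B → (B + A + n * B) + n * A ≡ suc n * (A + B)
  regroup₃ = solve-∀

[k+1]*nC[k+1]≡l*nCk : ∀ {n} k l → k + l ≡ n → suc k * (n C suc k) ≡ l * (n C k)
[k+1]*nC[k+1]≡l*nCk {n} k l refl = +-cancelʳ-≡ (k * (n C k)) _ _ (begin
  suc k * (n C suc k) + k * (n C k)  ≡⟨ [k+1]*nC[k+1]+k*nCk≡n*nCk n k ⟩
  (k + l) * (n C k)                  ≡⟨ *-distribʳ-+ (n C k) k l ⟩
  k * (n C k) + l * (n C k)          ≡⟨ +-comm (k * (n C k)) _ ⟩
  l * (n C k) + k * (n C k)          ∎)
  where open ≡-Reasoning

i[i+1][a+1]≤a²k[i+2+k] : ∀ a i k → 1 ≤ a → i ≤ a * k → i * suc i * (a + 1) ≤ k * (a * a) * (2 + i + k)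
i[i+1][a+1]≤a²k[i+2+k] a i k 1≤a i≤ak = begin
  i * suc i * (a + 1)        ≡⟨ *-assoc i (suc i) (a + 1) ⟩
  i * (suc i * (a + 1))      ≤⟨ *-monoʳ-≤ i [i+1][a+1]≤a[i+2+k] ⟩
  i * (a * (2 + i + k))      ≤⟨ *-monoˡ-≤ (a * (2 + i + k)) i≤ak ⟩
  a * k * (a * (2 + i + k))  ≡⟨ solve (a ∷ i ∷ k ∷ []) ⟩
  k * (a * a) * (2 + i + k)  ∎
  where
  open ≤-Reasoning
  [i+1][a+1]≤a[i+2+k] : suc i * (a + 1) ≤ a * (2 + i + k)
  [i+1][a+1]≤a[i+2+k] = begin
    suc i * (a + 1)          ≡⟨ solve (a ∷ i ∷ []) ⟩
    suc i * a + (1 + i)      ≤⟨ +-monoʳ-≤ (suc i * a) (+-mono-≤ 1≤a i≤ak) ⟩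
    suc i * a + (a + a * k)  ≡⟨ solve (a ∷ i ∷ k ∷ []) ⟩
    a * (2 + i + k)          ∎

[a+1]c₀+a²c₁≤a²c₂ : ∀ a i k c₀ c₁ c₂ .{{_ : NonZero i}} → 1 ≤ a → i ≤ a * k →
                    i * c₁ ≡ (2 + i + k) * c₀ → suc i * c₂ ≡ (1 + i + k) * c₁ →
                    c₀ * (a + 1) + c₁ * (a * a) ≤ c₂ * (a * a)
[a+1]c₀+a²c₁≤a²c₂ a i k c₀ c₁ c₂ 1≤a i≤ak ic₁≡ [i+1]c₂≡ = *-cancelˡ-≤ (i * suc i) {{m*n≢0 i (suc i)}} (begin
  i * suc i * (c₀ * (a + 1) + c₁ * (a * a))
    ≡⟨ solve (a ∷ i ∷ c₀ ∷ c₁ ∷ []) ⟩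
  c₀ * (i * suc i * (a + 1)) + suc i * (a * a) * (i * c₁)
    ≡⟨ cong (λ v → c₀ * (i * suc i * (a + 1)) + suc i * (a * a) * v) ic₁≡ ⟩
  c₀ * (i * suc i * (a + 1)) + suc i * (a * a) * ((2 + i + k) * c₀)
    ≤⟨ +-monoˡ-≤ _ (*-monoʳ-≤ c₀ (i[i+1][a+1]≤a²k[i+2+k] a i k 1≤a i≤ak)) ⟩
  c₀ * (k * (a * a) * (2 + i + k)) + suc i * (a * a) * ((2 + i + k) * c₀)
    ≡⟨ solve (a ∷ i ∷ k ∷ c₀ ∷ []) ⟩
  a * a * (1 + i + k) * ((2 + i + k) * c₀)
    ≡⟨ cong (λ v → a * a * (1 + i + k) * v) ic₁≡ ⟨
  a * a * (1 + i + k) * (i * c₁)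
    ≡⟨ solve (a ∷ i ∷ k ∷ c₁ ∷ []) ⟩
  i * (a * a) * ((1 + i + k) * c₁)
    ≡⟨ cong (λ v → i * (a * a) * v) [i+1]c₂≡ ⟨
  i * (a * a) * (suc i * c₂)
    ≡⟨ solve (a ∷ i ∷ c₂ ∷ []) ⟩
  i * suc i * (c₂ * (a * a)) ∎)
  where open ≤-Reasoning

a*n+i≤a*m⇒∃[k]n+k≡m : ∀ a n m i .{{_ : NonZero a}} → a * n + i ≤ a * m → ∃[ k ] n + k ≡ m × i ≤ a * k
a*n+i≤a*m⇒∃[k]n+k≡m a n m i an+i≤am = m ∸ n , m+[n∸m]≡n n≤m , i≤a[m∸n]
  where
  n≤m : n ≤ m
  n≤m = *-cancelˡ-≤ a (m+n≤o⇒m≤o (a * n) an+i≤am)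
  i≤a[m∸n] : i ≤ a * (m ∸ n)
  i≤a[m∸n] = subst (i ≤_) (sym (*-distribˡ-∸ a m n))
                   (m+n≤o⇒m≤o∸n i (subst (_≤ a * m) (+-comm (a * n) i) an+i≤am))

<r⇒i[2a+1]+[a-1]≤am : ∀ b m i .{{_ : NonZero m}} → i < r (suc b) m → i * suc (2 * suc b) + b ≤ suc b * m
<r⇒i[2a+1]+[a-1]≤am b m i i<r = m≤o∸n⇒m+n≤o (i * n) (≤-trans (n≤1+n b) (m≤m*n (suc b) m)) (begin
  i * n                    ≤⟨ *-monoˡ-≤ n (m<1+n⇒m≤n (subst (i <_) (+-comm q 1) i<r)) ⟩
  q * n                    ≤⟨ m/n*n≤m (suc b * m ∸ b) n ⟩
  suc b * m ∸ b            ∎)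
  where
  open ≤-Reasoning
  n = suc (2 * suc b)
  q = (suc b * m ∸ b) ℕ./ n

-- 2a ≡ -1 (mod 2a + 1), so doubling a m = i(2a + 1) + (a - 1) gives -m ≡ -3.
i[2a+1]+[a-1]≡am⇒m≡3 : ∀ b m i → i * suc (2 * suc b) + b ≡ suc b * m →
                       m % suc (2 * suc b) ≡ 3 % suc (2 * suc b)
i[2a+1]+[a-1]≡am⇒m≡3 b m i i[2a+1]+[a-1]≡am = begin
  m % n                      ≡⟨ [m+kn]%n≡m%n m (suc (2 * i)) n ⟨
  (m + suc (2 * i) * n) % n  ≡⟨ cong (_% n) (+-cancelʳ-≡ (2 * (suc b * m)) (m + suc (2 * i) * n) (3 + m * n) (begin
      m + suc (2 * i) * n + 2 * (suc b * m)  ≡⟨ regroup b m i ⟩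
      3 + m * n + 2 * (i * n + b)            ≡⟨ cong (λ v → 3 + m * n + 2 * v) i[2a+1]+[a-1]≡am ⟩
      3 + m * n + 2 * (suc b * m)            ∎)) ⟩
  (3 + m * n) % n            ≡⟨ [m+kn]%n≡m%n 3 m n ⟩
  3 % n                      ∎
  where
  open ≡-Reasoning
  n = suc (2 * suc b)
  regroup : ∀ b m i → m + suc (2 * i) * suc (2 * suc b) + 2 * (suc b * m)
                    ≡ 3 + m * suc (2 * suc b) + 2 * (i * suc (2 * suc b) + b)
  regroup = solve-∀

<r⇒a[2i+1]+i≤am : ∀ b m i .{{_ : NonZero m}} → m % suc (2 * suc b) ≢ 3 % suc (2 * suc b) →
                  i < r (suc b) m → suc b * suc (2 * i) + i ≤ suc b * m
<r⇒a[2i+1]+i≤am b m i m≢3 i<r =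
  subst (_≤ suc b * m) (regroup b i)
        (≤∧≢⇒< (<r⇒i[2a+1]+[a-1]≤am b m i i<r) (λ eq → m≢3 (i[2a+1]+[a-1]≡am⇒m≡3 b m i eq)))
  where
  regroup : ∀ b i → suc (i * suc (2 * suc b) + b) ≡ suc b * suc (2 * i) + i
  regroup = solve-∀

scale-by-a*p : ∀ a p c₀ c₁ c₂ → c₀ * (a + 1) + c₁ * (a * a) ≤ c₂ * (a * a) →
               (c₀ * p + c₁ * (a * p)) * (a * a) + c₀ * (a * p) ≤ c₂ * (a * p) * (a * a)
scale-by-a*p a p c₀ c₁ c₂ h = begin
  (c₀ * p + c₁ * (a * p)) * (a * a) + c₀ * (a * p)  ≡⟨ solve (a ∷ p ∷ c₀ ∷ c₁ ∷ []) ⟩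
  a * p * (c₀ * (a + 1) + c₁ * (a * a))             ≤⟨ *-monoʳ-≤ (a * p) h ⟩
  a * p * (c₂ * (a * a))                            ≡⟨ solve (a ∷ p ∷ c₂ ∷ []) ⟩
  c₂ * (a * p) * (a * a)                            ∎
  where open ≤-Reasoning

lemma3p3 : (a m : ℕ) → (ha : 1 ≤ a) → 4 ≤ m →
           m % (suc (2 * a)) ≢ 3 % (suc (2 * a)) →
           (i : ℕ) → 1 ≤ i → i < r a m →
           (⟦ (m C (i ∸ 1)) * a ^ (i ∸ 1) ⟧ ℚ.+ ⟦ (m C i) * a ^ i ⟧)
             ℚ.≤ (⟦ (m C (suc i)) * a ^ i ⟧ ℚ.- (⟦ m C (i ∸ 1) ⟧ ℚ.* pow-2 a i ha))
lemma3p3 a@(suc b) m@(suc _) ha _ m≢3 i@(suc j) _ i<r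
  with a*n+i≤a*m⇒∃[k]n+k≡m a (suc (2 * i)) m i (<r⇒a[2i+1]+i≤am b m i m≢3 i<r)
... | k , [2i+1]+k≡m , i≤ak =
  ⟦⟧+⟦⟧≤⟦⟧-⟦⟧*pow-2 i ((m C j) * a ^ j) ((m C i) * a ^ i) ((m C suc i) * a ^ i) (m C j) ha
    (scale-by-a*p a (a ^ j) (m C j) (m C i) (m C suc i)
      ([a+1]c₀+a²c₁≤a²c₂ a i k (m C j) (m C i) (m C suc i) ha i≤ak
        ([k+1]*nC[k+1]≡l*nCk j (2 + i + k) (trans (regroup₁ j k) [2i+1]+k≡m))
        ([k+1]*nC[k+1]≡l*nCk i (1 + i + k) (trans (regroup₂ j k) [2i+1]+k≡m))))
  where
  regroup₁ : ∀ j k → j + (2 + suc j + k) ≡ suc (2 * suc j) + k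
  regroup₁ = solve-∀
  regroup₂ : ∀ j k → suc j + (1 + suc j + k) ≡ suc (2 * suc j) + k
  regroup₂ = solve-∀
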